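{- Let $\mathcal T$ be a unitree. Let $e_1,e_2,e_3$ be three successive edges of a path in $\mathcal T$, so that $e_2$ shares one endpoint with $e_1$ and its other endpoint with $e_3$. Let $s,t,u$ be the weights of $e_1,e_2,e_3$, respectively. If $s\le u$, then $u=s$ or $u=s+t$. If $s\ge u$, then $u=s$ or $u=s-t$.
   Context: A weighted tree is a finite bicolored plane tree with positive integer edge weights. Bicolored means that vertices are black or white and every edge joins vertices of different colors. Plane means that a cyclic order of edges around each vertex is fixed. The degree of a vertex is the sum of the weights of its incident edges. The passport is the pair of partitions of the total weight formed by the black vertex degrees and the white vertex degrees. Two weighted trees are isomorphic if there is a color-preserving bijection of vertices and edges that respects incidence, cyclic orders at vertices, and weights. A unitree is a weighted tree such that every weighted tree with the same passport is isomorphic to it. Standing assumption: passports considered have $\gcd$ of all vertex degrees equal to $1$ and satisfy $p+q\le n+1$, where $n$ is the total weight and $p,q$ are the numbers of black and white vertices. -}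

module Defs where

open import Data.Nat using (ℕ; zero; suc; _+_; _≤_; _<_)
open import Data.Nat.Divisibility using (_∣_)
open import Data.Fin using (Fin)
open import Data.Fin.Properties using (_≟_)
open import Data.Fin.Permutation using (Permutation′; Permutation; _⟨$⟩ʳ_)
open import Data.List using (List; map; filter; allFin)
open import Data.Nat.ListAction using (sum)
open import Data.List.Relation.Binary.Permutation.Propositional using (_↭_)
open import Data.Product using (Σ; ∃; _×_)
open import Relation.Binary.PropositionalEquality using (_≡_; _≢_)
open import Data.Sum using (_⊎_)
open import Function using (_∘_)

iter : {A : Set} → (A → A) → ℕ → A → A
iter f zero    x = x
iter f (suc k) x = f (iter f k x)

-- Reachability of edges under the rotations σ (around black vertices)
-- and τ (around white vertices); used to express connectedness.
data Reach {m : ℕ} (σ τ : Fin m → Fin m) : Fin m → Fin m → Set where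
  here  : ∀ {e} → Reach σ τ e e
  stepσ : ∀ {e e'} → Reach σ τ (σ e) e' → Reach σ τ e e'
  stepτ : ∀ {e e'} → Reach σ τ (τ e) e' → Reach σ τ e e'

-- Each edge e joins black vertex bl e and white vertex wh e and has weight w e ≥ 1.
-- The plane structure: σ is a permutation of the edges whose cycles are exactly
-- the sets of edges around each black vertex (giving their cyclic order);
-- τ likewise for white vertices.
record WTree : Set where
  field
    p q m : ℕ
    bl    : Fin m → Fin p
    wh    : Fin m → Fin q
    w     : Fin m → ℕ
    w-pos : ∀ e → 0 < w e
    σ τ   : Permutation′ m
    σ-bl  : ∀ e → bl (σ ⟨$⟩ʳ e) ≡ bl e
    σ-cyc : ∀ e e' → bl e ≡ bl e' → ∃ λ k → iter (σ ⟨$⟩ʳ_) k e ≡ e'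
    τ-wh  : ∀ e → wh (τ ⟨$⟩ʳ e) ≡ wh e
    τ-cyc : ∀ e e' → wh e ≡ wh e' → ∃ λ k → iter (τ ⟨$⟩ʳ_) k e ≡ e'
    bl-onto : ∀ v → ∃ λ e → bl e ≡ v
    wh-onto : ∀ v → ∃ λ e → wh e ≡ v
    conn  : ∀ e e' → Reach (σ ⟨$⟩ʳ_) (τ ⟨$⟩ʳ_) e e'
    -- a connected graph with #edges = #vertices - 1 is a tree
    tree  : m + 1 ≡ p + q

open WTree public

totalWeight : WTree → ℕ
totalWeight T = sum (map (w T) (allFin (m T)))

blackDeg : (T : WTree) → Fin (p T) → ℕ
blackDeg T v = sum (map (w T) (filter (λ e → bl T e ≟ v) (allFin (m T))))

whiteDeg : (T : WTree) → Fin (q T) → ℕ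
whiteDeg T v = sum (map (w T) (filter (λ e → wh T e ≟ v) (allFin (m T))))

blackDegs whiteDegs : WTree → List ℕ
blackDegs T = map (blackDeg T) (allFin (p T))
whiteDegs T = map (whiteDeg T) (allFin (q T))

SamePassport : WTree → WTree → Set
SamePassport T T' = (blackDegs T ↭ blackDegs T') × (whiteDegs T ↭ whiteDegs T')

record Iso (T T' : WTree) : Set where
  field
    φ : Permutation (m T) (m T')
    β : Permutation (p T) (p T')
    γ : Permutation (q T) (q T')
    φ-bl : ∀ e → bl T' (φ ⟨$⟩ʳ e) ≡ β ⟨$⟩ʳ (bl T e)
    φ-wh : ∀ e → wh T' (φ ⟨$⟩ʳ e) ≡ γ ⟨$⟩ʳ (wh T e)
    φ-σ  : ∀ e → σ T' ⟨$⟩ʳ (φ ⟨$⟩ʳ e) ≡ φ ⟨$⟩ʳ (σ T ⟨$⟩ʳ e)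
    φ-τ  : ∀ e → τ T' ⟨$⟩ʳ (φ ⟨$⟩ʳ e) ≡ φ ⟨$⟩ʳ (τ T ⟨$⟩ʳ e)
    φ-w  : ∀ e → w T' (φ ⟨$⟩ʳ e) ≡ w T e

Unitree : WTree → Set
Unitree T = (T' : WTree) → SamePassport T T' → Iso T T'

DegGcdOne : WTree → Set
DegGcdOne T = ∀ d → (∀ v → d ∣ blackDeg T v) → (∀ v → d ∣ whiteDeg T v) → d ≡ 1

StandingAssumption : WTree → Set
StandingAssumption T = DegGcdOne T × (p T + q T ≤ totalWeight T + 1)

SuccessiveEdges : (T : WTree) → Fin (m T) → Fin (m T) → Fin (m T) → Set
SuccessiveEdges T e₁ e₂ e₃ =
  (e₁ ≢ e₂) × (e₂ ≢ e₃) ×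
  ((bl T e₁ ≡ bl T e₂ × wh T e₂ ≡ wh T e₃) ⊎ (wh T e₁ ≡ wh T e₂ × bl T e₂ ≡ bl T e₃))

{-# OPTIONS --safe #-}
-- Say e₁ and e₂ meet at the black vertex B, e₂ and e₃ at the white vertex W,
-- and e₃ ends at the black vertex D, with s < u.  Detach e₁ from B, reattach
-- it at D, and reweight e₂ to s + t and e₃ to u − s.  Every vertex degree is
-- unchanged (B loses s on e₁ and gains s on e₂, D gains s on e₁ and loses s on
-- e₃, W's gain and loss cancel), so the new tree has the same passport and,
-- T being a unitree, the same multiset of edge weights.  Only e₂ and e₃ changed
-- weight, and e₂ no longer has weight t, so the new weight u − s of e₃ must be
-- t.  The case s > u is the same argument read along the path backwards, the
-- colours play symmetric roles, and the standing assumption is never used.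
module Submission where

open import Defs
open import Data.Bool using (true; false; if_then_else_)
open import Data.Empty using (⊥-elim)
open import Data.Fin using (Fin; zero; suc; toℕ)
open import Data.Fin.Permutation
  using (Permutation′; _⟨$⟩ʳ_; _⟨$⟩ˡ_; inverseʳ; transpose; _∘ₚ_)
import Data.Fin.Permutation.Components as PC
open import Data.Fin.Properties using (_≟_; pigeonhole)
open import Data.List using (List; []; _∷_; map; filter; allFin; tabulate)
open import Data.List.Properties using (map-cong; map-tabulate)
open import Data.List.Relation.Binary.Permutation.Propositional using (_↭_; ↭-reflexive)
open import Data.Nat using (ℕ; zero; suc; _+_; _*_; _∸_; _≤_; _<_)
  renaming (_≟_ to _≟ℕ_)
open import Data.Nat.ListAction using (sum)
open import Data.Nat.Properties
  using ( +-assoc; +-comm; +-suc; *-suc; +-cancelˡ-≡; +-cancelʳ-≡; +-0-commutativeMonoid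
        ; 0≢1+n; n<1+n; <-irrefl; <⇒≤; <-≤-trans; m≤m+n; m<n+m; m+[n∸m]≡n; m<n⇒0<n∸m
        ; m≤n⇒∃[o]m+o≡n; m≤n⇒m<n∨m≡n; m+n∸n≡m )
open import Data.Nat.Tactic.RingSolver using (solve-∀)
open import Algebra.Properties.CommutativeMonoid.Sum +-0-commutativeMonoid
  using (sum-cong-≗; sum-permute) renaming (sum to ∑)
open import Data.Product using (∃; _×_; _,_)
open import Data.Sum using (_⊎_; inj₁; inj₂)
open import Function using (_∘_)
open import Function.Bundles using (Injection)
open import Function.Definitions using (Injective)
open import Function.Properties.Inverse using (↔⇒↣)
open import Relation.Nullary using (Dec; yes; no; does)
open import Relation.Nullary.Decidable using (dec-true; dec-false)
open import Relation.Unary using (Decidable)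
open import Relation.Binary.PropositionalEquality
  using (_≡_; _≢_; refl; sym; trans; cong; cong₂; subst; module ≡-Reasoning)

open ≡-Reasoning

-- Finite sums and vertex degrees

∑-tabulate : ∀ {n} (f : Fin n → ℕ) → sum (tabulate f) ≡ ∑ f
∑-tabulate {zero}  f = refl
∑-tabulate {suc n} f = cong (f zero +_) (∑-tabulate (f ∘ suc))

sum-filter : ∀ {A : Set} {P : A → Set} (P? : Decidable P) (f : A → ℕ) (xs : List A) →
  sum (map f (filter P? xs)) ≡ sum (map (λ x → if does (P? x) then f x else 0) xs)
sum-filter P? f []       = refl
sum-filter P? f (x ∷ xs) with does (P? x)
... | true  = cong (f x +_) (sum-filter P? f xs)
... | false = sum-filter P? f xs

weightAt : ∀ {k} → Fin k → Fin k → ℕ → ℕ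
weightAt v x a = if does (x ≟ v) then a else 0

degree : ∀ {m k} → (Fin m → Fin k) → (Fin m → ℕ) → Fin k → ℕ
degree col wt v = ∑ (λ e → weightAt v (col e) (wt e))

degrees : ∀ {m k} → (Fin m → Fin k) → (Fin m → ℕ) → List ℕ
degrees {m} {k} col wt = map (λ v → sum (map wt (filter (λ e → col e ≟ v) (allFin m)))) (allFin k)

degree-as-∑ : ∀ {m k} (col : Fin m → Fin k) (wt : Fin m → ℕ) v →
  sum (map wt (filter (λ e → col e ≟ v) (allFin m))) ≡ degree col wt v
degree-as-∑ {m} col wt v = begin
  sum (map wt (filter (λ e → col e ≟ v) (allFin m))) ≡⟨ sum-filter (λ e → col e ≟ v) wt (allFin m) ⟩
  sum (map F (allFin m))                             ≡⟨ cong sum (map-tabulate {n = m} (λ e → e) F) ⟩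
  sum (tabulate F)                                   ≡⟨ ∑-tabulate F ⟩
  degree col wt v                                    ∎
  where
  F : Fin m → ℕ
  F e = weightAt v (col e) (wt e)

degrees-cong : ∀ {m k} {col col′ : Fin m → Fin k} {wt wt′ : Fin m → ℕ} →
  (∀ v → degree col wt v ≡ degree col′ wt′ v) → degrees col wt ↭ degrees col′ wt′
degrees-cong {col = col} {col′} {wt} {wt′} eq = ↭-reflexive (map-cong (λ v →
  trans (degree-as-∑ col wt v) (trans (eq v) (sym (degree-as-∑ col′ wt′ v)))) _)

_without_ : ∀ {n} → (Fin n → ℕ) → Fin n → Fin n → ℕ
(F without i) e = if does (e ≟ i) then 0 else F e

without-≢ : ∀ {n} (F : Fin n → ℕ) {i e} → e ≢ i → (F without i) e ≡ F e
without-≢ F {i} {e} e≢i rewrite dec-false (e ≟ i) e≢i = refl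

∑-without : ∀ {n} (F : Fin n → ℕ) i → ∑ F ≡ F i + ∑ (F without i)
∑-without F zero    = refl
∑-without F (suc i) = begin
  F zero + ∑ (F ∘ suc)               ≡⟨ cong (F zero +_) (∑-without (F ∘ suc) i) ⟩
  F zero + (F (suc i) + R)           ≡⟨ sym (+-assoc (F zero) _ R) ⟩
  F zero + F (suc i) + R             ≡⟨ cong (_+ R) (+-comm (F zero) _) ⟩
  F (suc i) + F zero + R             ≡⟨ +-assoc (F (suc i)) _ R ⟩
  F (suc i) + (F zero + R)           ∎
  where R = ∑ ((F ∘ suc) without i)

module ThreePoints {n} {a b c : Fin n} (a≢b : a ≢ b) (a≢c : a ≢ c) (b≢c : b ≢ c) where

  AgreeOff : (F G : Fin n → ℕ) → Set
  AgreeOff F G = ∀ e → e ≢ a → e ≢ b → e ≢ c → F e ≡ G e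

  private
    rest : (Fin n → ℕ) → ℕ
    rest F = ∑ (((F without a) without b) without c)

    ∑-split : ∀ F → ∑ F ≡ (F a + (F b + F c)) + rest F
    ∑-split F = begin
      ∑ F                                 ≡⟨ ∑-without F a ⟩
      F a + ∑ Fa                          ≡⟨ cong (F a +_) (∑-without Fa b) ⟩
      F a + (Fa b + ∑ Fab)                ≡⟨ cong (λ x → F a + (x + ∑ Fab)) (without-≢ F (a≢b ∘ sym)) ⟩
      F a + (F b + ∑ Fab)                 ≡⟨ cong (λ x → F a + (F b + x)) (∑-without Fab c) ⟩
      F a + (F b + (Fab c + rest F))      ≡⟨ cong (λ x → F a + (F b + (x + rest F))) Fab-c ⟩
      F a + (F b + (F c + rest F))        ≡⟨ cong (F a +_) (sym (+-assoc (F b) (F c) (rest F))) ⟩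
      F a + ((F b + F c) + rest F)        ≡⟨ sym (+-assoc (F a) _ (rest F)) ⟩
      (F a + (F b + F c)) + rest F        ∎
      where
      Fa  = F without a
      Fab = Fa without b
      Fab-c : Fab c ≡ F c
      Fab-c = trans (without-≢ Fa (b≢c ∘ sym)) (without-≢ F (a≢c ∘ sym))

    rest-cong : ∀ {F G} → AgreeOff F G → rest F ≡ rest G
    rest-cong {F} {G} agree = sum-cong-≗ pointwise
      where
      pointwise : ∀ e → (((F without a) without b) without c) e ≡ (((G without a) without b) without c) e
      pointwise e with e ≟ c | e ≟ b | e ≟ a
      ... | yes _  | _      | _      = refl
      ... | no _   | yes _  | _      = refl
      ... | no _   | no _   | yes _  = refl
      ... | no e≢c | no e≢b | no e≢a = agree e e≢a e≢b e≢c

  ∑-cong₃ : ∀ {F G} → AgreeOff F G → F a + (F b + F c) ≡ G a + (G b + G c) → ∑ F ≡ ∑ G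
  ∑-cong₃ {F} {G} agree eq = begin
    ∑ F                           ≡⟨ ∑-split F ⟩
    (F a + (F b + F c)) + rest F  ≡⟨ cong₂ _+_ eq (rest-cong agree) ⟩
    (G a + (G b + G c)) + rest G  ≡⟨ sym (∑-split G) ⟩
    ∑ G                           ∎

  ∑-cancel₃ : ∀ {F G} → AgreeOff F G → ∑ F ≡ ∑ G → F a + (F b + F c) ≡ G a + (G b + G c)
  ∑-cancel₃ {F} {G} agree eq = +-cancelʳ-≡ (rest G) _ _ (begin
    (F a + (F b + F c)) + rest G  ≡⟨ cong (_ +_) (sym (rest-cong agree)) ⟩
    (F a + (F b + F c)) + rest F  ≡⟨ sym (∑-split F) ⟩
    ∑ F                           ≡⟨ eq ⟩
    ∑ G                           ≡⟨ ∑-split G ⟩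
    (G a + (G b + G c)) + rest G  ∎)

-- Orbits and reachability

iter-+ : ∀ {A : Set} (f : A → A) j k x → iter f j (iter f k x) ≡ iter f (j + k) x
iter-+ f zero    k x = refl
iter-+ f (suc j) k x = cong f (iter-+ f j k x)

iter-suc : ∀ {A : Set} (f : A → A) k x → iter f (suc k) x ≡ iter f k (f x)
iter-suc f k x = trans (cong (λ j → iter f j x) (+-comm 1 k)) (sym (iter-+ f k 1 x))

iter-injective : ∀ {A : Set} {f : A → A} → Injective _≡_ _≡_ f → ∀ k → Injective _≡_ _≡_ (iter f k)
iter-injective inj zero    eq = eq
iter-injective inj (suc k) eq = iter-injective inj k (inj eq)

iter-returns : ∀ {n} {f : Fin n → Fin n} → Injective _≡_ _≡_ f → ∀ x → ∃ λ d → iter f (suc d) x ≡ x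
iter-returns {n} {f} inj x with pigeonhole (n<1+n n) (λ i → iter f (toℕ i) x)
... | i , j , i<j , same with m≤n⇒∃[o]m+o≡n i<j
... | d , i+1+d≡j = d , sym (iter-injective inj (toℕ i) (begin
  iter f (toℕ i) x                  ≡⟨ same ⟩
  iter f (toℕ j) x                  ≡⟨ cong (λ k → iter f k x) (sym (trans (+-suc (toℕ i) d) i+1+d≡j)) ⟩
  iter f (toℕ i + suc d) x          ≡⟨ sym (iter-+ f (toℕ i) (suc d) x) ⟩
  iter f (toℕ i) (iter f (suc d) x) ∎))

iter-*-returns : ∀ {A : Set} (f : A → A) d x → iter f (suc d) x ≡ x → ∀ k → iter f (k * suc d) x ≡ x
iter-*-returns f d x ret zero    = refl
iter-*-returns f d x ret (suc k) = begin
  iter f (suc d + k * suc d) x          ≡⟨ sym (iter-+ f (suc d) (k * suc d) x) ⟩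
  iter f (suc d) (iter f (k * suc d) x) ≡⟨ cong (iter f (suc d)) (iter-*-returns f d x ret k) ⟩
  iter f (suc d) x                      ≡⟨ ret ⟩
  x                                     ∎

Orbit : ∀ {A : Set} → (A → A) → A → A → Set
Orbit f x y = ∃ λ k → iter f k x ≡ y

orbit-refl : ∀ {A : Set} {f : A → A} {x} → Orbit f x x
orbit-refl = 0 , refl

orbit-trans : ∀ {A : Set} {f : A → A} {x y z} → Orbit f x y → Orbit f y z → Orbit f x z
orbit-trans {f = f} {x} (j , refl) (k , refl) = k + j , sym (iter-+ f k j x)

orbit-step : ∀ {A : Set} {f : A → A} {x y} → Orbit f (f x) y → Orbit f x y
orbit-step = orbit-trans (1 , refl)

orbit-sym : ∀ {n} {f : Fin n → Fin n} → Injective _≡_ _≡_ f → ∀ {x y} → Orbit f x y → Orbit f y x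
orbit-sym {f = f} inj {x} (k , refl) with iter-returns inj x
... | d , ret = k * d , (begin
  iter f (k * d) (iter f k x) ≡⟨ iter-+ f (k * d) k x ⟩
  iter f (k * d + k) x        ≡⟨ cong (λ j → iter f j x) (trans (+-comm (k * d) k) (sym (*-suc k d))) ⟩
  iter f (k * suc d) x        ≡⟨ iter-*-returns f d x ret k ⟩
  x                           ∎)

orbit-transfer : ∀ {n} {f g : Fin n → Fin n} (Q : Fin n → Set) {z} →
  (∀ {x} → Q x → x ≢ z → f x ≡ g x × Q (g x)) →
  ∀ k {x} → Q x → iter g k x ≡ z → Orbit f x z
orbit-transfer Q step zero    _  refl = orbit-refl
orbit-transfer {f = f} {g} Q {z} step (suc k) {x} Qx reach with x ≟ z
... | yes refl = orbit-refl
... | no x≢z with step Qx x≢z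
...   | fx≡gx , Qgx = orbit-step (subst (λ y → Orbit f y z) (sym fx≡gx)
          (orbit-transfer Q step k Qgx (trans (sym (iter-suc g k x)) reach)))

Reach-trans : ∀ {n} {f g : Fin n → Fin n} {x y z} → Reach f g x y → Reach f g y z → Reach f g x z
Reach-trans here      r = r
Reach-trans (stepσ r) r' = stepσ (Reach-trans r r')
Reach-trans (stepτ r) r' = stepτ (Reach-trans r r')

Reach-swap : ∀ {n} {f g : Fin n → Fin n} {x y} → Reach f g x y → Reach g f x y
Reach-swap here      = here
Reach-swap (stepσ r) = stepτ (Reach-swap r)
Reach-swap (stepτ r) = stepσ (Reach-swap r)

orbitσ⇒Reach : ∀ {n} {f g : Fin n → Fin n} {x y} → Orbit f x y → Reach f g x y
orbitσ⇒Reach {f = f} {g} {x} (k , refl) = walk k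
  where
  walk : ∀ k → Reach f g x (iter f k x)
  walk zero    = here
  walk (suc k) = Reach-trans (walk k) (stepσ here)

orbitτ⇒Reach : ∀ {n} {f g : Fin n → Fin n} {x y} → Orbit g x y → Reach f g x y
orbitτ⇒Reach o = Reach-swap (orbitσ⇒Reach o)

⟨$⟩ʳ-injective : ∀ {n} (π : Permutation′ n) → Injective _≡_ _≡_ (π ⟨$⟩ʳ_)
⟨$⟩ʳ-injective π = Injection.injective (↔⇒↣ π)

transpose-i : ∀ {n} (i j : Fin n) → PC.transpose i j i ≡ j
transpose-i i j rewrite dec-true (i ≟ i) refl = refl

transpose-j : ∀ {n} (i j : Fin n) → j ≢ i → PC.transpose i j j ≡ i
transpose-j i j j≢i rewrite dec-false (j ≟ i) j≢i | dec-true (j ≟ j) refl = refl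

transpose-≢ : ∀ {n} (i j k : Fin n) → k ≢ i → k ≢ j → PC.transpose i j k ≡ k
transpose-≢ i j k k≢i k≢j rewrite dec-false (k ≟ i) k≢i | dec-false (k ≟ j) k≢j = refl

-- Moving an edge to another black vertex

module Reattach (T : WTree) {e₁ e₂ e₃ : Fin (m T)} (e₁≢e₂ : e₁ ≢ e₂)
  (b₁₂ : bl T e₁ ≡ bl T e₂) (w₂₃ : wh T e₂ ≡ wh T e₃) (B≢D : bl T e₁ ≢ bl T e₃) where

  private
    B D : Fin (p T)
    B = bl T e₁
    D = bl T e₃

    g h : Fin (m T) → Fin (m T)
    g = σ T ⟨$⟩ʳ_
    h = τ T ⟨$⟩ʳ_

    g-injective : Injective _≡_ _≡_ g
    g-injective = ⟨$⟩ʳ-injective (σ T)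

    P : Fin (m T)
    P = σ T ⟨$⟩ˡ e₁

    gP≡e₁ : g P ≡ e₁
    gP≡e₁ = inverseʳ (σ T)

    g≡e₁⇒≡P : ∀ {x} → g x ≡ e₁ → x ≡ P
    g≡e₁⇒≡P gx≡e₁ = g-injective (trans gx≡e₁ (sym gP≡e₁))

    bl-P : bl T P ≡ B
    bl-P = trans (sym (σ-bl T P)) (cong (bl T) gP≡e₁)

    e₁≢e₃ : e₁ ≢ e₃
    e₁≢e₃ e₁≡e₃ = B≢D (cong (bl T) e₁≡e₃)

    P≢e₃ : P ≢ e₃
    P≢e₃ P≡e₃ = B≢D (trans (sym bl-P) (cong (bl T) P≡e₃))

    -- e₂ lies in the cycle of e₁, so e₁ is not a fixed point
    P≢e₁ : P ≢ e₁
    P≢e₁ P≡e₁ with σ-cyc T e₁ e₂ b₁₂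
    ... | k , reach = e₁≢e₂ (trans (sym (stays k)) reach)
      where
      ge₁≡e₁ : g e₁ ≡ e₁
      ge₁≡e₁ = subst (λ x → g x ≡ e₁) P≡e₁ gP≡e₁
      stays : ∀ k → iter g k e₁ ≡ e₁
      stays zero    = refl
      stays (suc k) = trans (cong g (stays k)) ge₁≡e₁

    -- Cut e₁ out of its cycle (P ↦ g e₁) and splice it in after e₃ (e₃ ↦ e₁ ↦ g e₃).
    σ′ : Permutation′ (m T)
    σ′ = transpose e₁ e₃ ∘ₚ (transpose P e₁ ∘ₚ σ T)

    f : Fin (m T) → Fin (m T)
    f = σ′ ⟨$⟩ʳ_

    f-P : f P ≡ g e₁
    f-P rewrite transpose-≢ e₁ e₃ P P≢e₁ P≢e₃ | transpose-i P e₁ = refl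

    f-e₁ : f e₁ ≡ g e₃
    f-e₁ rewrite transpose-i e₁ e₃ | transpose-≢ P e₁ e₃ (P≢e₃ ∘ sym) (e₁≢e₃ ∘ sym) = refl

    f-e₃ : f e₃ ≡ e₁
    f-e₃ rewrite transpose-j e₁ e₃ (e₁≢e₃ ∘ sym) | transpose-j P e₁ (P≢e₁ ∘ sym) = gP≡e₁

    f-other : ∀ {x} → x ≢ P → x ≢ e₁ → x ≢ e₃ → f x ≡ g x
    f-other {x} x≢P x≢e₁ x≢e₃
      rewrite transpose-≢ e₁ e₃ x x≢e₁ x≢e₃ | transpose-≢ P e₁ x x≢P x≢e₁ = refl

  bl′ : Fin (m T) → Fin (p T)
  bl′ e = if does (e ≟ e₁) then D else bl T e

  bl′-e₁ : bl′ e₁ ≡ D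
  bl′-e₁ rewrite dec-true (e₁ ≟ e₁) refl = refl

  bl′-≢ : ∀ e → e ≢ e₁ → bl′ e ≡ bl T e
  bl′-≢ e e≢e₁ rewrite dec-false (e ≟ e₁) e≢e₁ = refl

  private
    bl′-e₂ : bl′ e₂ ≡ B
    bl′-e₂ = trans (bl′-≢ e₂ (e₁≢e₂ ∘ sym)) (sym b₁₂)

    bl′-e₃ : bl′ e₃ ≡ D
    bl′-e₃ = bl′-≢ e₃ (e₁≢e₃ ∘ sym)

    bl′-g : ∀ {x} → x ≢ P → bl′ (g x) ≡ bl T x
    bl′-g x≢P = trans (bl′-≢ _ (x≢P ∘ g≡e₁⇒≡P)) (σ-bl T _)

    bl′-≡B : ∀ {e} → bl′ e ≡ B → bl T e ≡ B × e ≢ e₁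
    bl′-≡B {e} eq = by-cases (e ≟ e₁)
      where
      by-cases : Dec (e ≡ e₁) → bl T e ≡ B × e ≢ e₁
      by-cases (yes refl) = ⊥-elim (B≢D (trans (sym eq) bl′-e₁))
      by-cases (no e≢e₁)  = trans (sym (bl′-≢ e e≢e₁)) eq , e≢e₁

    σ-bl′ : ∀ e → bl′ (f e) ≡ bl′ e
    σ-bl′ e = by-cases (e ≟ P) (e ≟ e₁) (e ≟ e₃)
      where
      by-cases : Dec (e ≡ P) → Dec (e ≡ e₁) → Dec (e ≡ e₃) → bl′ (f e) ≡ bl′ e
      by-cases (yes refl) _ _ = begin
        bl′ (f P)   ≡⟨ cong bl′ f-P ⟩
        bl′ (g e₁)  ≡⟨ bl′-g (P≢e₁ ∘ sym) ⟩
        B           ≡⟨ sym bl-P ⟩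
        bl T P      ≡⟨ sym (bl′-≢ P P≢e₁) ⟩
        bl′ P       ∎
      by-cases (no _) (yes refl) _ = begin
        bl′ (f e₁)  ≡⟨ cong bl′ f-e₁ ⟩
        bl′ (g e₃)  ≡⟨ bl′-g (P≢e₃ ∘ sym) ⟩
        D           ≡⟨ sym bl′-e₁ ⟩
        bl′ e₁      ∎
      by-cases (no _) (no _) (yes refl) = trans (cong bl′ f-e₃) (trans bl′-e₁ (sym bl′-e₃))
      by-cases (no e≢P) (no e≢e₁) (no e≢e₃) =
        trans (cong bl′ (f-other e≢P e≢e₁ e≢e₃)) (trans (bl′-g e≢P) (sym (bl′-≢ e e≢e₁)))

    to-P : ∀ {e} → bl′ e ≡ B → Orbit f e P
    to-P {e} eq with bl′-≡B eq
    ... | bl-e , e≢e₁ with σ-cyc T e P (trans bl-e (sym bl-P))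
    ...   | k , reach = orbit-transfer (λ x → bl T x ≡ B × x ≢ e₁) step k (bl-e , e≢e₁) reach
      where
      step : ∀ {x} → bl T x ≡ B × x ≢ e₁ → x ≢ P → f x ≡ g x × (bl T (g x) ≡ B × g x ≢ e₁)
      step (bl-x , x≢e₁) x≢P =
        f-other x≢P x≢e₁ (λ x≡e₃ → B≢D (trans (sym bl-x) (cong (bl T) x≡e₃))) ,
        trans (σ-bl T _) bl-x , x≢P ∘ g≡e₁⇒≡P

    along-D : ∀ {x} → bl T x ≡ D → Orbit f x e₃
    along-D {x} bl-x with σ-cyc T x e₃ bl-x
    ... | k , reach = orbit-transfer (λ y → bl T y ≡ D) step k bl-x reach
      where
      step : ∀ {y} → bl T y ≡ D → y ≢ e₃ → f y ≡ g y × bl T (g y) ≡ D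
      step {y} bl-y y≢e₃ =
        f-other (λ y≡P → B≢D (trans (sym bl-P) (trans (cong (bl T) (sym y≡P)) bl-y)))
                (λ y≡e₁ → B≢D (trans (cong (bl T) (sym y≡e₁)) bl-y)) y≢e₃ ,
        trans (σ-bl T y) bl-y

    to-e₃ : ∀ {e} → bl′ e ≡ D → Orbit f e e₃
    to-e₃ {e} eq = by-cases (e ≟ e₁)
      where
      by-cases : Dec (e ≡ e₁) → Orbit f e e₃
      by-cases (yes refl) = orbit-step (subst (λ x → Orbit f x e₃) (sym f-e₁) (along-D (σ-bl T e₃)))
      by-cases (no e≢e₁)  = along-D (trans (sym (bl′-≢ e e≢e₁)) eq)

    f-injective : Injective _≡_ _≡_ f
    f-injective = ⟨$⟩ʳ-injective σ′

    off-B-D : ∀ {x y} → bl T x ≢ B → bl T x ≢ D → bl T x ≡ bl T y → Orbit f x y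
    off-B-D {x} {y} x-B x-D eq with σ-cyc T x y eq
    ... | k , reach = orbit-transfer Q step k (x-B , x-D) reach
      where
      Q : Fin (m T) → Set
      Q z = bl T z ≢ B × bl T z ≢ D
      step : ∀ {z} → Q z → z ≢ y → f z ≡ g z × Q (g z)
      step {z} (z-B , z-D) _ =
        f-other (λ z≡P → z-B (trans (cong (bl T) z≡P) bl-P)) (λ z≡e₁ → z-B (cong (bl T) z≡e₁))
                (λ z≡e₃ → z-D (cong (bl T) z≡e₃)) ,
        z-B ∘ trans (sym (σ-bl T z)) , z-D ∘ trans (sym (σ-bl T z))

    σ-cyc′ : ∀ x y → bl′ x ≡ bl′ y → Orbit f x y
    σ-cyc′ x y eq = by-cases (bl′ x ≟ B) (bl′ x ≟ D)
      where
      by-cases : Dec (bl′ x ≡ B) → Dec (bl′ x ≡ D) → Orbit f x y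
      by-cases (yes x-B) _ = orbit-trans (to-P x-B) (orbit-sym f-injective (to-P (trans (sym eq) x-B)))
      by-cases (no _) (yes x-D) = orbit-trans (to-e₃ x-D) (orbit-sym f-injective (to-e₃ (trans (sym eq) x-D)))
      by-cases (no x-B) (no x-D) =
        off-B-D (x-B ∘ trans x-same) (x-D ∘ trans x-same) (trans (sym x-same) (trans eq y-same))
        where
        x-same : bl′ x ≡ bl T x
        x-same = bl′-≢ x (λ { refl → x-D bl′-e₁ })
        y-same : bl′ y ≡ bl T y
        y-same = bl′-≢ y (λ { refl → x-D (trans eq bl′-e₁) })

    reach-e₁-e₂ : Reach f h e₁ e₂
    reach-e₁-e₂ =
      Reach-trans (orbitσ⇒Reach (to-e₃ bl′-e₁)) (orbitτ⇒Reach (τ-cyc T e₃ e₂ (sym w₂₃)))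

    reach-e₂-e₁ : Reach f h e₂ e₁
    reach-e₂-e₁ = Reach-trans (orbitτ⇒Reach (τ-cyc T e₂ e₃ w₂₃)) (orbitσ⇒Reach (1 , f-e₃))

    reach-same-black : ∀ {x y} → bl T x ≡ bl T y → Reach f h x y
    reach-same-black {x} {y} eq = by-cases (x ≟ e₁) (y ≟ e₁)
      where
      by-cases : Dec (x ≡ e₁) → Dec (y ≡ e₁) → Reach f h x y
      by-cases (yes refl) (yes refl) = here
      by-cases (yes refl) (no y≢e₁) =
        Reach-trans reach-e₁-e₂
          (orbitσ⇒Reach (σ-cyc′ e₂ y (trans bl′-e₂ (trans eq (sym (bl′-≢ y y≢e₁))))))
      by-cases (no x≢e₁) (yes refl) =
        Reach-trans (orbitσ⇒Reach (σ-cyc′ x e₂ (trans (bl′-≢ x x≢e₁) (trans eq (sym bl′-e₂)))))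
          reach-e₂-e₁
      by-cases (no x≢e₁) (no y≢e₁) =
        orbitσ⇒Reach (σ-cyc′ x y (trans (bl′-≢ x x≢e₁) (trans eq (sym (bl′-≢ y y≢e₁)))))

    Reach-reattached : ∀ {x y} → Reach g h x y → Reach f h x y
    Reach-reattached here      = here
    Reach-reattached (stepτ r) = stepτ (Reach-reattached r)
    Reach-reattached {x} (stepσ r) = Reach-trans (reach-same-black (sym (σ-bl T x))) (Reach-reattached r)

    bl′-onto : ∀ v → ∃ λ e → bl′ e ≡ v
    bl′-onto v with bl-onto T v
    ... | e , bl-e with e ≟ e₁
    ...   | yes refl = e₂ , trans bl′-e₂ bl-e
    ...   | no e≢e₁  = e , trans (bl′-≢ e e≢e₁) bl-e

  reattached : WTree
  reattached = record T
    { bl = bl′ ; σ = σ′ ; σ-bl = σ-bl′ ; σ-cyc = σ-cyc′ ; bl-onto = bl′-onto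
    ; conn = λ x y → Reach-reattached (conn T x y) }

-- Rebalancing weights along the path

weightAt₃ : ∀ {k} → Fin k → Fin k → Fin k → Fin k → ℕ → ℕ → ℕ → ℕ
weightAt₃ v x y z a b c = weightAt v x a + (weightAt v y b + weightAt v z c)

weightAt₃-reattach : ∀ {k} (v B D : Fin k) s t r →
  weightAt₃ v B B D s t (s + r) ≡ weightAt₃ v D B D s (s + t) r
weightAt₃-reattach v B D s t r with does (B ≟ v) | does (D ≟ v)
... | true  | true  = regroup s t r
  where
  regroup : ∀ s t r → s + (t + (s + r)) ≡ s + ((s + t) + r)
  regroup = solve-∀
... | true  | false = regroup s t
  where
  regroup : ∀ s t → s + (t + 0) ≡ (s + t) + 0
  regroup = solve-∀
... | false | true  = refl
... | false | false = refl

weightAt₃-shift : ∀ {k} (v X Y : Fin k) s t r →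
  weightAt₃ v X Y Y s t (s + r) ≡ weightAt₃ v X Y Y s (s + t) r
weightAt₃-shift v X Y s t r with does (Y ≟ v)
... | true  = cong (weightAt v X s +_) (regroup s t r)
  where
  regroup : ∀ s t r → t + (s + r) ≡ (s + t) + r
  regroup = solve-∀
... | false = refl

δ : ℕ → ℕ → ℕ
δ t z = if does (z ≟ℕ t) then 1 else 0

δ-refl : ∀ t → δ t t ≡ 1
δ-refl t rewrite dec-true (t ≟ℕ t) refl = refl

δ-≢ : ∀ {t z} → z ≢ t → δ t z ≡ 0
δ-≢ {t} {z} z≢t rewrite dec-false (z ≟ℕ t) z≢t = refl

∑-weights-invariant : ∀ {T T′} → Iso T T′ → (F : ℕ → ℕ) → ∑ (F ∘ w T′) ≡ ∑ (F ∘ w T)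
∑-weights-invariant {T} {T′} iso F =
  trans (sum-permute (F ∘ w T′) φ) (sum-cong-≗ (cong F ∘ φ-w))
  where open Iso iso

module Forcing (T : WTree) {e₁ e₂ e₃ : Fin (m T)} (e₁≢e₂ : e₁ ≢ e₂) (e₂≢e₃ : e₂ ≢ e₃)
  (b₁₂ : bl T e₁ ≡ bl T e₂) (w₂₃ : wh T e₂ ≡ wh T e₃) (s<u : w T e₁ < w T e₃) where

  private
    s t u r : ℕ
    s = w T e₁
    t = w T e₂
    u = w T e₃
    r = u ∸ s

    s+r≡u : s + r ≡ u
    s+r≡u = m+[n∸m]≡n (<⇒≤ s<u)

    e₁≢e₃ : e₁ ≢ e₃
    e₁≢e₃ e₁≡e₃ = <-irrefl (cong (w T) e₁≡e₃) s<u

    open ThreePoints e₁≢e₂ e₁≢e₃ e₂≢e₃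

    w′ : Fin (m T) → ℕ
    w′ e = if does (e ≟ e₂) then s + t else if does (e ≟ e₃) then r else w T e

    w′-e₁ : w′ e₁ ≡ s
    w′-e₁ rewrite dec-false (e₁ ≟ e₂) e₁≢e₂ | dec-false (e₁ ≟ e₃) e₁≢e₃ = refl

    w′-e₂ : w′ e₂ ≡ s + t
    w′-e₂ rewrite dec-true (e₂ ≟ e₂) refl = refl

    w′-e₃ : w′ e₃ ≡ r
    w′-e₃ rewrite dec-false (e₃ ≟ e₂) (e₂≢e₃ ∘ sym) | dec-true (e₃ ≟ e₃) refl = refl

    w′-other : ∀ {e} → e ≢ e₂ → e ≢ e₃ → w′ e ≡ w T e
    w′-other {e} e≢e₂ e≢e₃ rewrite dec-false (e ≟ e₂) e≢e₂ | dec-false (e ≟ e₃) e≢e₃ = refl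

    w′-pos : ∀ e → 0 < w′ e
    w′-pos e with does (e ≟ e₂)
    ... | true = <-≤-trans (w-pos T e₁) (m≤m+n s t)
    ... | false with does (e ≟ e₃)
    ...   | true  = m<n⇒0<n∸m s<u
    ...   | false = w-pos T e

    degrees-preserved : ∀ {k} (col col′ : Fin (m T) → Fin k) → (∀ e → e ≢ e₁ → col′ e ≡ col e) →
      (∀ v → weightAt₃ v (col e₁) (col e₂) (col e₃) s t u
           ≡ weightAt₃ v (col′ e₁) (col′ e₂) (col′ e₃) (w′ e₁) (w′ e₂) (w′ e₃)) →
      degrees col (w T) ↭ degrees col′ w′
    degrees-preserved col col′ col′-other at-path = degrees-cong {col = col} {col′} {w T} {w′} λ v →
      ∑-cong₃ (λ e e≢e₁ e≢e₂ e≢e₃ →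
                 cong₂ (weightAt v) (sym (col′-other e e≢e₁)) (sym (w′-other e≢e₂ e≢e₃)))
              (at-path v)

    passport : (bl″ : Fin (m T) → Fin (p T)) →
      bl″ e₁ ≡ bl T e₃ → (∀ e → e ≢ e₁ → bl″ e ≡ bl T e) →
      (degrees (bl T) (w T) ↭ degrees bl″ w′) × (degrees (wh T) (w T) ↭ degrees (wh T) w′)
    passport bl″ bl″-e₁ bl″-other =
      degrees-preserved (bl T) bl″ bl″-other black , degrees-preserved (wh T) (wh T) (λ _ _ → refl) white
      where
      B D : Fin (p T)
      B = bl T e₂
      D = bl T e₃
      X Y : Fin (q T)
      X = wh T e₁
      Y = wh T e₃

      black : ∀ v → weightAt₃ v (bl T e₁) B D s t u
                  ≡ weightAt₃ v (bl″ e₁) (bl″ e₂) (bl″ e₃) (w′ e₁) (w′ e₂) (w′ e₃)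
      black v rewrite b₁₂ | bl″-e₁ | bl″-other e₂ (e₁≢e₂ ∘ sym) | bl″-other e₃ (e₁≢e₃ ∘ sym)
                    | w′-e₁ | w′-e₂ | w′-e₃ =
        trans (cong (weightAt₃ v B B D s t) (sym s+r≡u)) (weightAt₃-reattach v B D s t r)

      white : ∀ v → weightAt₃ v X (wh T e₂) Y s t u
                  ≡ weightAt₃ v X (wh T e₂) Y (w′ e₁) (w′ e₂) (w′ e₃)
      white v rewrite w₂₃ | w′-e₁ | w′-e₂ | w′-e₃ =
        trans (cong (weightAt₃ v X Y Y s t) (sym s+r≡u)) (weightAt₃-shift v X Y s t r)

    weight-forced : ∑ (δ t ∘ w′) ≡ ∑ (δ t ∘ w T) → u ≡ s + t
    weight-forced same-count with r ≟ℕ t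
    ... | yes r≡t = trans (sym s+r≡u) (cong (s +_) r≡t)
    ... | no r≢t  = ⊥-elim (0≢1+n (trans (sym (δ-≢ r≢t)) count-r))
      where
      new-counts : δ t (w′ e₁) + (δ t (w′ e₂) + δ t (w′ e₃)) ≡ δ t s + (δ t (s + t) + δ t r)
      new-counts rewrite w′-e₁ | w′-e₂ | w′-e₃ = refl

      at-path : δ t s + (δ t (s + t) + δ t r) ≡ δ t s + (δ t t + δ t u)
      at-path = trans (sym new-counts)
        (∑-cancel₃ (λ e _ e≢e₂ e≢e₃ → cong (δ t) (w′-other e≢e₂ e≢e₃)) same-count)

      s+t≢t : s + t ≢ t
      s+t≢t s+t≡t = <-irrefl (sym s+t≡t) (m<n+m t (w-pos T e₁))

      count-r : δ t r ≡ suc (δ t u)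
      count-r = begin
        δ t r                ≡⟨ cong (_+ δ t r) (sym (δ-≢ s+t≢t)) ⟩
        δ t (s + t) + δ t r  ≡⟨ +-cancelˡ-≡ (δ t s) _ _ at-path ⟩
        δ t t + δ t u        ≡⟨ cong (_+ δ t u) (δ-refl t) ⟩
        suc (δ t u)          ∎

  unitree-forces : Unitree T → u ≡ s + t
  unitree-forces U with bl T e₁ ≟ bl T e₃
  -- impossible in a tree, but then reweighting alone already preserves the passport
  ... | yes B≡D = weight-forced (∑-weights-invariant (U T′ (passport (bl T) B≡D (λ _ _ → refl))) (δ t))
    where
    T′ : WTree
    T′ = record T { w = w′ ; w-pos = w′-pos }
  ... | no B≢D = weight-forced (∑-weights-invariant (U T′ (passport bl′ bl′-e₁ bl′-≢)) (δ t))
    where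
    open Reattach T e₁≢e₂ b₁₂ w₂₃ B≢D
    T′ : WTree
    T′ = record reattached { w = w′ ; w-pos = w′-pos }

-- Colour duality and reversal of the path

dual : WTree → WTree
dual T = record
  { p = q T ; q = p T ; m = m T ; bl = wh T ; wh = bl T ; w = w T ; w-pos = w-pos T
  ; σ = τ T ; τ = σ T ; σ-bl = τ-wh T ; σ-cyc = τ-cyc T ; τ-wh = σ-bl T ; τ-cyc = σ-cyc T
  ; bl-onto = wh-onto T ; wh-onto = bl-onto T ; conn = λ x y → Reach-swap (conn T x y)
  ; tree = trans (tree T) (+-comm (p T) (q T)) }

Iso-dual : ∀ {T T′} → Iso T (dual T′) → Iso (dual T) T′
Iso-dual iso = record
  { φ = φ ; β = γ ; γ = β ; φ-bl = φ-wh ; φ-wh = φ-bl ; φ-σ = φ-τ ; φ-τ = φ-σ ; φ-w = φ-w }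
  where open Iso iso

Unitree-dual : ∀ {T} → Unitree T → Unitree (dual T)
Unitree-dual U T′ (black , white) = Iso-dual (U (dual T′) (white , black))

SuccessiveEdges-reverse : ∀ {T e₁ e₂ e₃} → SuccessiveEdges T e₁ e₂ e₃ → SuccessiveEdges T e₃ e₂ e₁
SuccessiveEdges-reverse (e₁≢e₂ , e₂≢e₃ , inj₁ (b₁₂ , w₂₃)) =
  e₂≢e₃ ∘ sym , e₁≢e₂ ∘ sym , inj₂ (sym w₂₃ , sym b₁₂)
SuccessiveEdges-reverse (e₁≢e₂ , e₂≢e₃ , inj₂ (w₁₂ , b₂₃)) =
  e₂≢e₃ ∘ sym , e₁≢e₂ ∘ sym , inj₁ (sym b₂₃ , sym w₁₂)

unitree-increasing : ∀ T → Unitree T → ∀ {e₁ e₂ e₃} → SuccessiveEdges T e₁ e₂ e₃ →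
  w T e₁ < w T e₃ → w T e₃ ≡ w T e₁ + w T e₂
unitree-increasing T U (e₁≢e₂ , e₂≢e₃ , inj₁ (b₁₂ , w₂₃)) s<u =
  Forcing.unitree-forces T e₁≢e₂ e₂≢e₃ b₁₂ w₂₃ s<u U
unitree-increasing T U (e₁≢e₂ , e₂≢e₃ , inj₂ (w₁₂ , b₂₃)) s<u =
  Forcing.unitree-forces (dual T) e₁≢e₂ e₂≢e₃ w₁₂ b₂₃ s<u (Unitree-dual U)

lemma5p12 : (T : WTree) → StandingAssumption T → Unitree T →
    (e₁ e₂ e₃ : Fin (m T)) → SuccessiveEdges T e₁ e₂ e₃ →
    (w T e₁ ≤ w T e₃ → (w T e₃ ≡ w T e₁ ⊎ w T e₃ ≡ w T e₁ + w T e₂))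
    × (w T e₃ ≤ w T e₁ → (w T e₃ ≡ w T e₁ ⊎ w T e₃ ≡ w T e₁ ∸ w T e₂))
lemma5p12 T _ U e₁ e₂ e₃ path = increasing , decreasing
  where
  increasing : w T e₁ ≤ w T e₃ → (w T e₃ ≡ w T e₁ ⊎ w T e₃ ≡ w T e₁ + w T e₂)
  increasing s≤u with m≤n⇒m<n∨m≡n s≤u
  ... | inj₁ s<u = inj₂ (unitree-increasing T U path s<u)
  ... | inj₂ s≡u = inj₁ (sym s≡u)

  decreasing : w T e₃ ≤ w T e₁ → (w T e₃ ≡ w T e₁ ⊎ w T e₃ ≡ w T e₁ ∸ w T e₂)
  decreasing u≤s with m≤n⇒m<n∨m≡n u≤s
  ... | inj₂ u≡s = inj₁ u≡s
  ... | inj₁ u<s = inj₂ (begin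
    w T e₃                    ≡⟨ sym (m+n∸n≡m (w T e₃) (w T e₂)) ⟩
    w T e₃ + w T e₂ ∸ w T e₂  ≡⟨ cong (_∸ w T e₂) (sym s≡u+t) ⟩
    w T e₁ ∸ w T e₂           ∎)
    where
    s≡u+t : w T e₁ ≡ w T e₃ + w T e₂
    s≡u+t = unitree-increasing T U (SuccessiveEdges-reverse {T} path) u<s
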